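{- Let $(X,\mathcal{B})$ be a design in which every $2$-subset of $X$ is contained in exactly one block, and let $G$ be its incidence graph with vertex bipartition $X \cup \mathcal{B}$; assume $G$ is connected. Then for all $u,u' \in X$ with $u \ne u'$ and $v \in \mathcal{B}$ such that $N(u) \cap N(u') = \{v\}$, $|N(u)| \ge 2$ and $|N(u')| \ge 2$, we have $$\zeta(G) \le |N(u)| + |N(u')| + |N(v)| - 3.$$
   Context: A design $(X,\mathcal{B})$ consists of a finite set $X$ of points and a collection $\mathcal{B}$ of blocks, each a subset of $X$. Its incidence graph is the bipartite graph with vertex set $X \cup \mathcal{B}$ in which $x \in X$ is adjacent to $B \in \mathcal{B}$ iff $x \in B$; $N(\cdot)$ denotes neighbourhood in this graph. Localization game on a finite connected graph $G$ with $k$ cops: the robber chooses a starting vertex, invisible to the cops. In each round the cops first choose any $k$ vertices (not restricted by adjacency), and each cop learns the distance from its vertex to the robber's current vertex. The cops win if after finitely many rounds they determine the robber's vertex uniquely from the probe information; otherwise the robber moves to a neighbouring vertex or stays, and a new round begins. The robber knows the cops' strategy in advance. The localization number $\zeta(G)$ is the least $k$ such that $k$ cops can guarantee capture. -}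

module Defs where

open import Data.Nat using (ℕ; zero; suc; _+_; _≤_)
open import Data.Bool using (Bool; true; false; _∧_; _∨_; if_then_else_)
open import Data.Fin using (Fin)
import Data.Fin as Fin
open import Data.Fin.Subset using (Subset; _∈_)
open import Data.Vec using (Vec; tabulate; lookup)
import Data.Vec as Vec
open import Data.List using (List; []; _∷_; _++_; allFin)
open import Data.Bool.ListAction using (any)
import Data.List as List
open import Data.Sum using (_⊎_; inj₁; inj₂)
open import Data.Sum.Properties using (≡-dec)
open import Data.Product using (Σ; _×_; ∃; ∃-syntax)
open import Relation.Nullary using (¬_)
open import Relation.Nullary.Decidable using (⌊_⌋)
open import Relation.Binary.PropositionalEquality using (_≡_; _≢_)
open import Relation.Binary.Definitions using (DecidableEquality)
open import Relation.Binary.Construct.Closure.ReflexiveTransitive using (Star)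

module Graph {V : Set} (_≟V_ : DecidableEquality V) (verts : List V)
             (adj : V → V → Bool) where

  Adj : V → V → Set
  Adj x y = adj x y ≡ true

  Connected : Set
  Connected = ∀ x y → Star Adj x y

  reach : ℕ → V → V → Bool
  reach zero x y = ⌊ x ≟V y ⌋
  reach (suc d) x y = reach d x y ∨ any (λ z → reach d x z ∧ adj z y) verts

  search : ℕ → ℕ → V → V → ℕ
  search zero d x y = d
  search (suc f) d x y = if reach d x y then d else search f (suc d) x y

  -- shortest-path distance (the fuel |V| suffices in a connected graph)
  dist : V → V → ℕ
  dist x y = search (List.length verts) 0 x y

  -- A strategy for k cops: from the history of all previous probe answers
  -- (most recent first) choose k vertices to probe.
  Strategy : ℕ → Set
  Strategy k = List (Vec ℕ k) → Vec V k

  RobberWalk : (ℕ → V) → Set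
  RobberWalk w = ∀ i → (w (suc i) ≡ w i) ⊎ Adj (w i) (w (suc i))

  history : ∀ {k} → Strategy k → (ℕ → V) → ℕ → List (Vec ℕ k)
  history σ w zero = []
  history σ w (suc i) =
    Vec.map (λ c → dist c (w i)) (σ (history σ w i)) ∷ history σ w i

  CopsWin : ℕ → Set
  CopsWin k = Σ (Strategy k) λ σ →
    ∀ w → RobberWalk w → ∃[ n ] (∀ w' → RobberWalk w' →
        history σ w' (suc n) ≡ history σ w (suc n) → w' n ≡ w n)

  -- ζ(G) ≤ m  (ζ is the least k for which k cops win)
  ζ≤ : ℕ → Set
  ζ≤ m = ∃[ k ] (k ≤ m × CopsWin k)

-- Designs with point set Fin p and blocks indexed by Fin b
-- (block c : Subset p; repeated blocks are allowed).

module Design {p b : ℕ} (block : Fin b → Subset p) where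

  PairsInUniqueBlock : Set
  PairsInUniqueBlock = ∀ (x y : Fin p) → x ≢ y →
    Σ (Fin b) λ c → x ∈ block c × y ∈ block c ×
      (∀ c' → x ∈ block c' → y ∈ block c' → c' ≡ c)

  Vtx : Set
  Vtx = Fin p ⊎ Fin b

  incAdj : Vtx → Vtx → Bool
  incAdj (inj₁ x) (inj₂ c) = lookup (block c) x
  incAdj (inj₂ c) (inj₁ x) = lookup (block c) x
  incAdj _ _ = false

  verts : List Vtx
  verts = List.map inj₁ (allFin p) ++ List.map inj₂ (allFin b)

  open Graph (≡-dec Fin._≟_ Fin._≟_) verts incAdj public

  Npt : Fin p → Subset b
  Npt x = tabulate λ c → lookup (block c) x

  -- N(c) for a block c is the block itself: block c

module Submission where

-- Choose blocks B₀ ∋ u and B′ ∋ u′ other than v. Cops stand permanently on the blocks of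
-- (N(u) ∖ {B₀}) ∪ N(u′) and on the points of N(v) ∖ {u, u′}, that is on
-- |N(u)| + |N(u′)| + |N(v)| − 4 vertices, and one more cop probes the blocks one at a time.
-- A robber on a point x is at distance 1 from exactly the probed blocks through x, and at
-- distance 0 from x if x is probed; as two points share at most one block, these answers
-- determine x.
-- Blocks are pairwise non-adjacent, so a robber starting on a block C either steps onto a
-- point, where it is located, or still sits on C in the round in which C is probed.

open import Defs
open import Data.Nat using (ℕ; zero; suc; _+_; _∸_; _≤_; s≤s; z≤n)
open import Data.Nat.Properties
  using (_<?_; m+[n∸m]≡n; m+n∸m≡n; ≤-refl; ≤-trans; n≤1+n; ≤-reflexive; m≤m+n;
         +-mono-≤; +-monoˡ-≤; ∸-monoˡ-≤; module ≤-Reasoning)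
open import Data.Nat.Tactic.RingSolver using (solve-∀)
open import Data.Bool using (Bool; true; false; _∧_; _∨_; if_then_else_; T)
open import Data.Bool.ListAction using (any)
open import Data.Bool.Properties using (T-≡; T-∧)
open import Data.Fin using (Fin; zero; suc; toℕ; fromℕ<)
import Data.Fin as Fin
open import Data.Fin.Properties using (any?; toℕ<n; fromℕ<-toℕ)
open import Data.Fin.Subset using (Subset; inside; outside; _∈_; _∉_; _⊆_; _∩_; _-_; ⁅_⁆; ∣_∣)
open import Data.Fin.Subset.Properties
  using (_∈?_; x∈p∩q⁻; x∈p∧x≢y⇒x∈p-y; x∈p⇒∣p-x∣<∣p∣; x∈⁅x⁆; ∣⁅x⁆∣≡1; p⊆q⇒∣p∣≤∣q∣)
open import Data.List using (List; []; _∷_; _++_; length; allFin)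
import Data.List as List
import Data.List.Properties as List
open import Data.List.Membership.Propositional using () renaming (_∈_ to _∈ₗ_)
open import Data.List.Membership.Propositional.Properties using (∈-map⁺; ∈-++⁺ˡ; ∈-++⁺ʳ; ∈-allFin)
open import Data.List.Relation.Unary.Any using (here; there; satisfied)
import Data.List.Relation.Unary.Any as Any
open import Data.List.Relation.Unary.Any.Properties using (any⁻; any⁺)
open import Data.Vec using ([]; _∷_)
import Data.Vec as Vec
open import Data.Vec.Properties
  using (∷-injectiveˡ; ∷-injectiveʳ; lookup∘tabulate; []=⇒lookup; lookup⇒[]=)
open import Data.Product using (_×_; _,_; ∃-syntax; proj₁; proj₂)
open import Data.Sum using (_⊎_; inj₁; inj₂)
open import Data.Sum.Properties using (≡-dec; inj₁-injective)
open import Data.Empty using (⊥; ⊥-elim)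
open import Function using (Equivalence; case_of_; id; _∘_)
open import Relation.Nullary using (¬_; yes; no; contradiction)
open import Relation.Nullary.Decidable using (⌊_⌋; toWitness; fromWitness; _×-dec_; ¬?)
open import Relation.Binary.PropositionalEquality
open import Relation.Binary.Definitions using (DecidableEquality)

map-fromList-pointwise : ∀ {A B : Set} {f g : A → B} {l : List A} →
  Vec.map f (Vec.fromList l) ≡ Vec.map g (Vec.fromList l) → ∀ {a} → a ∈ₗ l → f a ≡ g a
map-fromList-pointwise {l = _ ∷ _} e (here refl) = ∷-injectiveˡ e
map-fromList-pointwise {l = _ ∷ _} e (there a∈) = map-fromList-pointwise (∷-injectiveʳ e) a∈

elements : ∀ {n} → Subset n → List (Fin n)
elements [] = []
elements (inside ∷ p) = zero ∷ List.map suc (elements p)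
elements (outside ∷ p) = List.map suc (elements p)

length-elements : ∀ {n} (p : Subset n) → length (elements p) ≡ ∣ p ∣
length-elements [] = refl
length-elements (inside ∷ p) = cong suc (trans (List.length-map suc (elements p)) (length-elements p))
length-elements (outside ∷ p) = trans (List.length-map suc (elements p)) (length-elements p)

∈-elements : ∀ {n} {p : Subset n} {x} → x ∈ p → x ∈ₗ elements p
∈-elements {p = inside ∷ p} Vec.here = here refl
∈-elements {p = inside ∷ p} (Vec.there x∈p) = there (∈-map⁺ suc (∈-elements x∈p))
∈-elements {p = outside ∷ p} (Vec.there x∈p) = ∈-map⁺ suc (∈-elements x∈p)

∣p-x-y∣+2≤∣p∣ : ∀ {n} {p : Subset n} {x y} → x ∈ p → y ∈ p → y ≢ x → 2 + ∣ p - x - y ∣ ≤ ∣ p ∣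
∣p-x-y∣+2≤∣p∣ x∈p y∈p y≢x =
  ≤-trans (s≤s (x∈p⇒∣p-x∣<∣p∣ (x∈p∧x≢y⇒x∈p-y y∈p y≢x))) (x∈p⇒∣p-x∣<∣p∣ x∈p)

another-element : ∀ {n} {p : Subset n} → 2 ≤ ∣ p ∣ → ∀ x → ∃[ y ] y ∈ p × y ≢ x
another-element {p = p} 2≤∣p∣ x with any? (λ y → y ∈? p ×-dec ¬? (y Fin.≟ x))
... | yes found = found
... | no none =
  contradiction (≤-trans 2≤∣p∣ (≤-trans (p⊆q⇒∣p∣≤∣q∣ p⊆⁅x⁆) (≤-reflexive (∣⁅x⁆∣≡1 x)))) λ { (s≤s ()) }
  where
  p⊆⁅x⁆ : p ⊆ ⁅ x ⁆
  p⊆⁅x⁆ {y} y∈p with y Fin.≟ x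
  ... | yes refl = x∈⁅x⁆ x
  ... | no y≢x = ⊥-elim (none (y , y∈p , y≢x))

2≤-if-distinct : ∀ {n} {i j : Fin n} → i ≢ j → 2 ≤ n
2≤-if-distinct {suc zero} {zero} {zero} i≢j = ⊥-elim (i≢j refl)
2≤-if-distinct {suc (suc n)} _ = s≤s (s≤s z≤n)

1+a+B+d≤A+B+D∸3 : ∀ {a d A D} B → 2 + a ≤ A → 2 + d ≤ D →
                   suc (a + (B + d)) ≤ A + B + D ∸ 3
1+a+B+d≤A+B+D∸3 {a} {d} {A} {D} B 2+a≤A 2+d≤D = begin
  suc (a + (B + d))          ≡⟨ sym (m+n∸m≡n 3 (suc (a + (B + d)))) ⟩
  3 + suc (a + (B + d)) ∸ 3  ≡⟨ cong (_∸ 3) (regroup a B d) ⟩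
  2 + a + B + (2 + d) ∸ 3    ≤⟨ ∸-monoˡ-≤ 3 (+-mono-≤ (+-monoˡ-≤ B 2+a≤A) 2+d≤D) ⟩
  A + B + D ∸ 3              ∎
  where
  open ≤-Reasoning
  regroup : ∀ a B d → 3 + suc (a + (B + d)) ≡ 2 + a + B + (2 + d)
  regroup = solve-∀

module Localization {V : Set} (_≟V_ : DecidableEquality V) (verts : List V) (adj : V → V → Bool)
    (∈-verts : ∀ z → z ∈ₗ verts) (2≤∣verts∣ : 2 ≤ length verts) where

  open Graph _≟V_ verts adj

  private
    search-≥ : ∀ f d x y → d ≤ search f d x y
    search-≥ zero d x y = ≤-refl
    search-≥ (suc f) d x y with reach d x y
    ... | true = ≤-refl
    ... | false = ≤-trans (n≤1+n d) (search-≥ f (suc d) x y)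

    oneStep : V → V → Bool
    oneStep x y = any (λ z → ⌊ x ≟V z ⌋ ∧ adj z y) verts

    oneStep⇒Adj : ∀ {x y} → oneStep x y ≡ true → Adj x y
    oneStep⇒Adj {x} {y} s with satisfied (any⁻ _ verts (Equivalence.from T-≡ s))
    ... | z , xz∧zy with Equivalence.to (T-∧ {⌊ x ≟V z ⌋}) xz∧zy
    ...   | x≡z , zy rewrite toWitness x≡z = Equivalence.to T-≡ zy

    Adj⇒oneStep : ∀ {x y} → Adj x y → oneStep x y ≡ true
    Adj⇒oneStep {x} {y} xy = Equivalence.to T-≡ (any⁺ _ (Any.map step (∈-verts x)))
      where
      step : ∀ {z} → x ≡ z → T (⌊ x ≟V z ⌋ ∧ adj z y)
      step refl = Equivalence.from T-∧ (fromWitness refl , Equivalence.from T-≡ xy)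

    dist-unfold : ∀ x y → dist x y ≡
      (if ⌊ x ≟V y ⌋ then 0
       else if ⌊ x ≟V y ⌋ ∨ oneStep x y then 1
       else search (length verts ∸ 2) 2 x y)
    dist-unfold x y = cong (λ n → search n 0 x y) (sym (m+[n∸m]≡n 2≤∣verts∣))

  data DistView (x y : V) : Set where
    same     : x ≡ y → dist x y ≡ 0 → DistView x y
    adjacent : x ≢ y → Adj x y → dist x y ≡ 1 → DistView x y
    far      : x ≢ y → ¬ Adj x y → 2 ≤ dist x y → DistView x y

  dist-view : ∀ x y → DistView x y
  dist-view x y with x ≟V y | dist-unfold x y
  ... | yes x≡y | d = same x≡y d
  ... | no x≢y | d with oneStep x y in s
  ...   | true = adjacent x≢y (oneStep⇒Adj s) d
  ...   | false = far x≢y (λ xy → case trans (sym s) (Adj⇒oneStep xy) of λ ())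
                    (≤-trans (search-≥ (length verts ∸ 2) 2 x y) (≤-reflexive (sym d)))

  dist-refl : ∀ x → dist x x ≡ 0
  dist-refl x with dist-view x x
  ... | same _ d = d
  ... | adjacent x≢x _ _ = ⊥-elim (x≢x refl)
  ... | far x≢x _ _ = ⊥-elim (x≢x refl)

  dist≡0⇒≡ : ∀ {x y} → dist x y ≡ 0 → x ≡ y
  dist≡0⇒≡ {x} {y} d with dist-view x y
  ... | same x≡y _ = x≡y
  ... | adjacent _ _ d′ = case trans (sym d) d′ of λ ()
  ... | far _ _ 2≤d = case ≤-trans 2≤d (≤-reflexive d) of λ ()

  dist≡1⇒Adj : ∀ {x y} → dist x y ≡ 1 → Adj x y
  dist≡1⇒Adj {x} {y} d with dist-view x y
  ... | same _ d′ = case trans (sym d) d′ of λ ()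
  ... | adjacent _ xy _ = xy
  ... | far _ _ 2≤d = case ≤-trans 2≤d (≤-reflexive d) of λ { (s≤s ()) }

  Adj⇒dist≡1 : ∀ {x y} → x ≢ y → Adj x y → dist x y ≡ 1
  Adj⇒dist≡1 {x} {y} x≢y xy with dist-view x y
  ... | same x≡y _ = ⊥-elim (x≢y x≡y)
  ... | adjacent _ _ d = d
  ... | far _ ¬xy _ = ⊥-elim (¬xy xy)

  Resolves : List V → (V → Set) → Set
  Resolves L S = ∀ {x z} → S x → (∀ {c} → c ∈ₗ L → dist c z ≡ dist c x) → z ≡ x

  module Sweep (L : List V) (S : V → Set) (sweep : ℕ → V) where

    strategy : Strategy (suc (length L))
    strategy h = Vec.fromList (sweep (length h) ∷ L)

    length-history : ∀ w n → length (history strategy w n) ≡ n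
    length-history w zero = refl
    length-history w (suc n) = cong suc (length-history w n)

    same-answers : ∀ w w′ n → history strategy w′ (suc n) ≡ history strategy w (suc n) →
                   ∀ {c} → c ∈ₗ sweep n ∷ L → dist c (w′ n) ≡ dist c (w n)
    same-answers w w′ n e {c} c∈ = map-fromList-pointwise answers c∈′
      where
      answers : Vec.map (λ c → dist c (w′ n)) (strategy (history strategy w n))
              ≡ Vec.map (λ c → dist c (w n)) (strategy (history strategy w n))
      answers = subst (λ h → Vec.map (λ c → dist c (w′ n)) (strategy h) ≡ _)
                      (List.∷-injectiveʳ e) (List.∷-injectiveˡ e)
      c∈′ : c ∈ₗ sweep (length (history strategy w n)) ∷ L
      c∈′ rewrite length-history w n = c∈

    Located : (ℕ → V) → ℕ → Set
    Located w n = ∀ w′ → RobberWalk w′ →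
                  history strategy w′ (suc n) ≡ history strategy w (suc n) → w′ n ≡ w n

    located-if-swept : ∀ w n → w n ≡ sweep n → Located w n
    located-if-swept w n wn≡ w′ _ e = sym (dist≡0⇒≡ (trans probe (dist-refl (w n))))
      where
      probe : dist (w n) (w′ n) ≡ dist (w n) (w n)
      probe = subst (λ c → dist c (w′ n) ≡ dist c (w n)) (sym wn≡)
                    (same-answers w w′ n e (here refl))

    module _ (resolves : Resolves L S) where

      located-if-resolved : ∀ w n → S (w n) → Located w n
      located-if-resolved w n s w′ _ e = resolves s (λ c∈ → same-answers w w′ n e (there c∈))

      stays-or-resolved : ∀ w → RobberWalk w → (∀ {z} → Adj (w 0) z → S z) →
                          ∀ j → (∃[ i ] S (w i)) ⊎ w j ≡ w 0
      stays-or-resolved w walk nbrs zero = inj₂ refl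
      stays-or-resolved w walk nbrs (suc j) with stays-or-resolved w walk nbrs j
      ... | inj₁ r = inj₁ r
      ... | inj₂ wj≡w0 with walk j
      ...   | inj₁ stay = inj₂ (trans stay wj≡w0)
      ...   | inj₂ move = inj₁ (suc j , nbrs (subst (λ z → Adj z (w (suc j))) wj≡w0 move))

      sweep-wins : (∀ z → S z ⊎ ∃[ n ] sweep n ≡ z) → (∀ n {z} → Adj (sweep n) z → S z) →
                   CopsWin (suc (length L))
      sweep-wins covers sweep-nbrs = strategy , capture
        where
        capture : ∀ w → RobberWalk w → ∃[ n ] Located w n
        capture w walk with covers (w 0)
        ... | inj₁ s = 0 , located-if-resolved w 0 s
        ... | inj₂ (m , sm≡w0)
          with stays-or-resolved w walk (λ a → sweep-nbrs m (subst (λ z → Adj z _) (sym sm≡w0) a)) m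
        ...   | inj₁ (i , s) = i , located-if-resolved w i s
        ...   | inj₂ wm≡w0 = m , located-if-swept w m (trans wm≡w0 (sym sm≡w0))

module Lines {p b : ℕ} {block : Fin b → Subset p} (pairs : Design.PairsInUniqueBlock block) where

  line : ∀ {x y} → x ≢ y → ∃[ c ] x ∈ block c × y ∈ block c
  line {x} {y} x≢y with pairs x y x≢y
  ... | c , x∈c , y∈c , _ = c , x∈c , y∈c

  meet-once : ∀ {x y c c′} → x ≢ y → x ∈ block c → y ∈ block c →
              x ∈ block c′ → y ∈ block c′ → c ≡ c′
  meet-once {x} {y} x≢y x∈c y∈c x∈c′ y∈c′ with pairs x y x≢y
  ... | _ , _ , _ , unique = trans (unique _ x∈c y∈c) (sym (unique _ x∈c′ y∈c′))

module Mimicry {p b : ℕ} {block : Fin b → Subset p} (pairs : Design.PairsInUniqueBlock block)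
    {u u′ : Fin p} {v B₀ B′ : Fin b} (u≢u′ : u ≢ u′) (u∈v : u ∈ block v) (u′∈v : u′ ∈ block v)
    (u′∈B′ : u′ ∈ block B′) (B′≢v : B′ ≢ v) where

  open Lines pairs

  Probed : Fin b → Set
  Probed c = (u ∈ block c × c ≢ B₀) ⊎ u′ ∈ block c

  Marked : Fin p → Set
  Marked y = y ∈ block v × y ≢ u × y ≢ u′

  Mimics : Fin p → Fin p → Set
  Mimics x x′ = (∀ {c} → Probed c → x ∈ block c → x′ ∈ block c) × (Marked x → x ≡ x′)

  ¬u′-mimics-u : ¬ Mimics u′ u
  ¬u′-mimics-u (m , _) = B′≢v (meet-once u≢u′ (m (inj₂ u′∈B′) u′∈B′) u′∈B′ u∈v u′∈v)

  marked-or-centre : ∀ {y} → y ∈ block v → Marked y ⊎ (y ≡ u ⊎ y ≡ u′)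
  marked-or-centre {y} y∈v with y Fin.≟ u | y Fin.≟ u′
  ... | yes y≡u | _ = inj₂ (inj₁ y≡u)
  ... | no _ | yes y≡u′ = inj₂ (inj₂ y≡u′)
  ... | no y≢u | no y≢u′ = inj₁ (y∈v , y≢u , y≢u′)

  mimic-on-v : ∀ {x x′} → x ∈ block v → Mimics x x′ → Mimics x′ x → x ≡ x′
  mimic-on-v x∈v m m′ with marked-or-centre x∈v | marked-or-centre (proj₁ m (inj₂ u′∈v) x∈v)
  ... | inj₁ marked | _ = proj₂ m marked
  ... | _ | inj₁ marked = sym (proj₂ m′ marked)
  ... | inj₂ (inj₁ refl) | inj₂ (inj₁ refl) = refl
  ... | inj₂ (inj₂ refl) | inj₂ (inj₂ refl) = refl
  ... | inj₂ (inj₁ refl) | inj₂ (inj₂ refl) = ⊥-elim (¬u′-mimics-u m′)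
  ... | inj₂ (inj₂ refl) | inj₂ (inj₁ refl) = ⊥-elim (¬u′-mimics-u m)

  module OutsideV {x x′} (x∉v : x ∉ block v) (x≢x′ : x ≢ x′)
                  (m : Mimics x x′) (m′ : Mimics x′ x) where

    Joins : Fin b → Set
    Joins c = x ∈ block c × x′ ∈ block c

    x′∉v : x′ ∉ block v
    x′∉v x′∈v = x∉v (proj₁ m′ (inj₂ u′∈v) x′∈v)

    u′-joins : ∃[ c ] u′ ∈ block c × Joins c
    u′-joins with line {u′} {x} (λ { refl → x∉v u′∈v })
    ... | c , u′∈c , x∈c = c , u′∈c , x∈c , proj₁ m (inj₂ u′∈c) x∈c

    u-joins : ∃[ c ] u ∈ block c × Joins c
    u-joins with line {u} {x} (λ { refl → x∉v u∈v }) | line {u} {x′} (λ { refl → x′∉v u∈v })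
    ... | c , u∈c , x∈c | c′ , u∈c′ , x′∈c′ with c Fin.≟ B₀ | c′ Fin.≟ B₀
    ...   | no c≢B₀ | _ = c , u∈c , x∈c , proj₁ m (inj₁ (u∈c , c≢B₀)) x∈c
    ...   | yes _ | no c′≢B₀ = c′ , u∈c′ , proj₁ m′ (inj₁ (u∈c′ , c′≢B₀)) x′∈c′ , x′∈c′
    ...   | yes refl | yes refl = c , u∈c , x∈c , x′∈c′

    absurd : ⊥
    absurd with u-joins | u′-joins
    ... | c , u∈c , x∈c , x′∈c | c′ , u′∈c′ , x∈c′ , x′∈c′ =
      x∉v (subst (λ d → x ∈ block d) c≡v x∈c)
      where
      c≡v : c ≡ v
      c≡v = meet-once u≢u′ u∈c (subst (λ d → u′ ∈ block d) c′≡c u′∈c′) u∈v u′∈v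
        where c′≡c = meet-once x≢x′ x∈c′ x′∈c′ x∈c x′∈c

  mutual-mimics⇒≡ : ∀ {x x′} → Mimics x x′ → Mimics x′ x → x ≡ x′
  mutual-mimics⇒≡ {x} {x′} m m′ with x Fin.≟ x′ | x ∈? block v
  ... | yes x≡x′ | _ = x≡x′
  ... | no _ | yes x∈v = mimic-on-v x∈v m m′
  ... | no x≢x′ | no x∉v = ⊥-elim (OutsideV.absurd x∉v x≢x′ m m′)

module IncidenceGraph {p b : ℕ} (block : Fin b → Subset p) where
  open Design block

  ∈-verts : ∀ z → z ∈ₗ verts
  ∈-verts (inj₁ x) = ∈-++⁺ˡ (∈-map⁺ inj₁ (∈-allFin x))
  ∈-verts (inj₂ c) = ∈-++⁺ʳ (List.map inj₁ (allFin p)) (∈-map⁺ inj₂ (∈-allFin c))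

  length-verts : length verts ≡ p + b
  length-verts = trans (List.length-++ (List.map inj₁ (allFin p)))
    (cong₂ _+_ (trans (List.length-map inj₁ (allFin p)) (List.length-tabulate {n = p} id))
               (trans (List.length-map inj₂ (allFin b)) (List.length-tabulate {n = b} id)))

  ∈block⇒Adj : ∀ {x c} → x ∈ block c → Adj (inj₂ c) (inj₁ x)
  ∈block⇒Adj = []=⇒lookup

  Adj⇒∈block : ∀ {x c} → Adj (inj₂ c) (inj₁ x) → x ∈ block c
  Adj⇒∈block {x} {c} = lookup⇒[]= x (block c)

  block-neighbour-is-point : ∀ {c z} → Adj (inj₂ c) z → ∃[ x ] z ≡ inj₁ x
  block-neighbour-is-point {z = inj₁ x} _ = x , refl

  ∈Npt⁺ : ∀ {x c} → x ∈ block c → c ∈ Npt x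
  ∈Npt⁺ {x} {c} x∈c = lookup⇒[]= c (Npt x) (trans (lookup∘tabulate _ c) ([]=⇒lookup x∈c))

  ∈Npt⁻ : ∀ {x c} → c ∈ Npt x → x ∈ block c
  ∈Npt⁻ {x} {c} c∈Nx = lookup⇒[]= x (block c) (trans (sym (lookup∘tabulate _ c)) ([]=⇒lookup c∈Nx))

module Capture {p b : ℕ} {block : Fin b → Subset p} (pairs : Design.PairsInUniqueBlock block)
    {u u′ : Fin p} {v B₀ B′ : Fin b} (u≢u′ : u ≢ u′) (u∈v : u ∈ block v) (u′∈v : u′ ∈ block v)
    (u∈B₀ : u ∈ block B₀) (B₀≢v : B₀ ≢ v) (u′∈B′ : u′ ∈ block B′) (B′≢v : B′ ≢ v) where

  open Design block
  open IncidenceGraph block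
  open Lines pairs
  open Mimicry pairs {B₀ = B₀} u≢u′ u∈v u′∈v u′∈B′ B′≢v

  2≤∣verts∣ : 2 ≤ length verts
  2≤∣verts∣ = ≤-trans (≤-trans (2≤-if-distinct u≢u′) (m≤m+n p b)) (≤-reflexive (sym length-verts))

  open Localization (≡-dec Fin._≟_ Fin._≟_) verts incAdj ∈-verts 2≤∣verts∣

  blocks-of-u blocks-of-u′ points-of-v : List Vtx
  blocks-of-u = List.map inj₂ (elements (Npt u - B₀ - v))
  blocks-of-u′ = List.map inj₂ (elements (Npt u′))
  points-of-v = List.map inj₁ (elements (block v - u - u′))

  probes : List Vtx
  probes = blocks-of-u ++ blocks-of-u′ ++ points-of-v

  probed∈probes : ∀ {c} → Probed c → inj₂ c ∈ₗ probes
  probed∈probes (inj₂ u′∈c) = ∈-++⁺ʳ blocks-of-u (∈-++⁺ˡ (∈-map⁺ inj₂ (∈-elements (∈Npt⁺ u′∈c))))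
  probed∈probes {c} (inj₁ (u∈c , c≢B₀)) with c Fin.≟ v
  ... | yes refl = probed∈probes (inj₂ u′∈v)
  ... | no c≢v =
    ∈-++⁺ˡ (∈-map⁺ inj₂ (∈-elements (x∈p∧x≢y⇒x∈p-y (x∈p∧x≢y⇒x∈p-y (∈Npt⁺ u∈c) c≢B₀) c≢v)))

  marked∈probes : ∀ {y} → Marked y → inj₁ y ∈ₗ probes
  marked∈probes (y∈v , y≢u , y≢u′) =
    ∈-++⁺ʳ blocks-of-u (∈-++⁺ʳ blocks-of-u′
      (∈-map⁺ inj₁ (∈-elements (x∈p∧x≢y⇒x∈p-y (x∈p∧x≢y⇒x∈p-y y∈v y≢u) y≢u′))))

  probed-block-through : ∀ x → ∃[ c ] Probed c × x ∈ block c
  probed-block-through x with x Fin.≟ u′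
  ... | yes refl = v , inj₂ u′∈v , u′∈v
  ... | no x≢u′ with line (x≢u′ ∘ sym)
  ...   | c , u′∈c , x∈c = c , inj₂ u′∈c , x∈c

  probe-sees-point : ∀ {c x z} → x ∈ block c →
                     dist (inj₂ c) z ≡ dist (inj₂ c) (inj₁ x) → Adj (inj₂ c) z
  probe-sees-point x∈c agree = dist≡1⇒Adj (trans agree (Adj⇒dist≡1 (λ ()) (∈block⇒Adj x∈c)))

  mimics-if-answers-agree : ∀ {x x′} →
    (∀ {c} → c ∈ₗ probes → dist c (inj₁ x′) ≡ dist c (inj₁ x)) → Mimics x x′
  mimics-if-answers-agree {x} {x′} agree = blocks , points
    where
    blocks : ∀ {c} → Probed c → x ∈ block c → x′ ∈ block c
    blocks pc x∈c = Adj⇒∈block (probe-sees-point x∈c (agree (probed∈probes pc)))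
    points : Marked x → x ≡ x′
    points mx = inj₁-injective (dist≡0⇒≡ (trans (agree (marked∈probes mx)) (dist-refl (inj₁ x))))

  IsPoint : Vtx → Set
  IsPoint z = ∃[ x ] z ≡ inj₁ x

  probes-resolve-points : Resolves probes IsPoint
  probes-resolve-points {z = z} (x , refl) agree with probed-block-through x
  ... | c , pc , x∈c
    with block-neighbour-is-point {c} {z} (probe-sees-point x∈c (agree (probed∈probes pc)))
  ...   | x′ , refl = cong inj₁ (sym (mutual-mimics⇒≡ (mimics-if-answers-agree agree)
                                                     (mimics-if-answers-agree (sym ∘ agree))))

  blockAt : ℕ → Fin b
  blockAt n with n <? b
  ... | yes n<b = fromℕ< n<b
  ... | no _ = v

  blockAt-toℕ : ∀ c → blockAt (toℕ c) ≡ c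
  blockAt-toℕ c with toℕ c <? b
  ... | yes c<b = fromℕ<-toℕ c c<b
  ... | no c≮b = contradiction (toℕ<n c) c≮b

  copsWin : CopsWin (suc (length probes))
  copsWin = Sweep.sweep-wins probes IsPoint (inj₂ ∘ blockAt) probes-resolve-points covers
                             (λ _ → block-neighbour-is-point)
    where
    covers : ∀ z → IsPoint z ⊎ ∃[ n ] inj₂ (blockAt n) ≡ z
    covers (inj₁ x) = inj₁ (x , refl)
    covers (inj₂ c) = inj₂ (toℕ c , cong inj₂ (blockAt-toℕ c))

  length-probes : length probes ≡ ∣ Npt u - B₀ - v ∣ + (∣ Npt u′ ∣ + ∣ block v - u - u′ ∣)
  length-probes = trans (List.length-++ blocks-of-u)
    (cong₂ _+_ (length-map-elements inj₂ (Npt u - B₀ - v))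
      (trans (List.length-++ blocks-of-u′)
        (cong₂ _+_ (length-map-elements inj₂ (Npt u′)) (length-map-elements inj₁ (block v - u - u′)))))
    where
    length-map-elements : ∀ {n} {A : Set} (f : Fin n → A) p → length (List.map f (elements p)) ≡ ∣ p ∣
    length-map-elements f p = trans (List.length-map f (elements p)) (length-elements p)

  ζ≤-bound : ζ≤ (∣ Npt u ∣ + ∣ Npt u′ ∣ + ∣ block v ∣ ∸ 3)
  ζ≤-bound = suc (length probes) , bound , copsWin
    where
    bound : suc (length probes) ≤ ∣ Npt u ∣ + ∣ Npt u′ ∣ + ∣ block v ∣ ∸ 3
    bound rewrite length-probes =
      1+a+B+d≤A+B+D∸3 ∣ Npt u′ ∣ (∣p-x-y∣+2≤∣p∣ (∈Npt⁺ u∈B₀) (∈Npt⁺ u∈v) (B₀≢v ∘ sym))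
                                  (∣p-x-y∣+2≤∣p∣ u∈v u′∈v (u≢u′ ∘ sym))

theorem2p2 : ∀ (p b : ℕ) (block : Fin b → Subset p) →
    Design.PairsInUniqueBlock block →
    Design.Connected block →
    ∀ (u u' : Fin p) (v : Fin b) → u ≢ u' →
    Design.Npt block u ∩ Design.Npt block u' ≡ ⁅ v ⁆ →
    2 ≤ ∣ Design.Npt block u ∣ →
    2 ≤ ∣ Design.Npt block u' ∣ →
    Design.ζ≤ block (∣ Design.Npt block u ∣ + ∣ Design.Npt block u' ∣ + ∣ block v ∣ ∸ 3)
theorem2p2 p b block pairs _ u u′ v u≢u′ Nu∩Nu′≡⁅v⁆ 2≤∣Nu∣ 2≤∣Nu′∣
  with x∈p∩q⁻ _ _ (subst (v ∈_) (sym Nu∩Nu′≡⁅v⁆) (x∈⁅x⁆ v))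
     | another-element 2≤∣Nu∣ v
     | another-element 2≤∣Nu′∣ v
... | v∈Nu , v∈Nu′ | B₀ , B₀∈Nu , B₀≢v | B′ , B′∈Nu′ , B′≢v =
  Capture.ζ≤-bound pairs u≢u′ (∈Npt⁻ v∈Nu) (∈Npt⁻ v∈Nu′) (∈Npt⁻ B₀∈Nu) B₀≢v (∈Npt⁻ B′∈Nu′) B′≢v
  where open IncidenceGraph block
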